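{- Let $\mathcal X$ be the fundamental pattern of a matroid $M$. Then $\operatorname{mr}\mathcal R(\mathcal X)=\operatorname{tri}(\mathcal X)=r(M)$, and $M$ is the unique matroid of this rank in $\mathcal R(\mathcal X)$.
   Context: The fundamental pattern of a matroid $M$ is the $\{0,*\}$-matrix with one row for each hyperplane of $M$ and one column for each element of $E(M)$ (columns labeled by the elements), whose entry in row $H$, column $e$ is $0$ if and only if $e\in H$. For a pattern $\mathcal Y$, the zero set of a row is the set of column labels where it has entry $0$; $\mathcal R(\mathcal Y)$ is the set of matroids on the set of column labels of $\mathcal Y$ in which the zero set of every row is a flat; $\operatorname{mr}\mathcal R(\mathcal Y)$ is the smallest rank of a matroid in it. A square pattern is a triangle if its rows and columns can be permuted independently to give a lower triangular pattern with all diagonal entries $*$; $\operatorname{tri}(\mathcal Y)$ is the largest $k$ such that some $k\times k$ submatrix of $\mathcal Y$ is a triangle. -}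

module Defs where

open import Data.Nat using (ℕ; _≤_; _<_; _+_)
open import Data.Bool using (Bool; true; false; if_then_else_)
open import Data.Fin using (Fin; _<_)
open import Data.Fin.Subset using (Subset; inside; outside; _∈_; _∉_; _⊆_; _∪_; _∩_; ⁅_⁆; ∣_∣; ⊤)
open import Data.Vec using (tabulate)
open import Data.Product using (Σ; _×_; ∃; ∃-syntax)
open import Function.Definitions using (Injective)
open import Relation.Binary.PropositionalEquality using (_≡_)

record Matroid (n : ℕ) : Set where
  field
    rk      : Subset n → ℕ
    rk-card : ∀ X → rk X ≤ ∣ X ∣
    rk-mono : ∀ {X Y} → X ⊆ Y → rk X ≤ rk Y
    rk-sub  : ∀ X Y → rk (X ∪ Y) + rk (X ∩ Y) ≤ rk X + rk Y
open Matroid public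

rank : ∀ {n} → Matroid n → ℕ
rank M = rk M ⊤

_≈M_ : ∀ {n} → Matroid n → Matroid n → Set
M ≈M N = ∀ X → rk M X ≡ rk N X

IsFlat : ∀ {n} → Matroid n → Subset n → Set
IsFlat M X = ∀ e → e ∉ X → Data.Nat._<_ (rk M X) (rk M (X ∪ ⁅ e ⁆))

IsHyperplane : ∀ {n} → Matroid n → Subset n → Set
IsHyperplane M H = IsFlat M H × (rk M H + 1 ≡ rank M)

-- A {0,*}-pattern with m rows and n columns; entry true means *, false means 0.
Pattern : ℕ → ℕ → Set
Pattern m n = Fin m → Fin n → Bool

zeroSet : ∀ {m n} → Pattern m n → Fin m → Subset n
zeroSet Y i = tabulate (λ e → if Y i e then outside else inside)

-- Y is the fundamental pattern of M: rows correspond bijectively to hyperplanes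
-- (row i ↦ its zero set), columns are the elements of E(M) = Fin n.
IsFundamentalPattern : ∀ {m n} → Matroid n → Pattern m n → Set
IsFundamentalPattern {m} {n} M Y =
  (∀ i → IsHyperplane M (zeroSet Y i)) ×
  (∀ i j → zeroSet Y i ≡ zeroSet Y j → i ≡ j) ×
  (∀ H → IsHyperplane M H → ∃[ i ] zeroSet Y i ≡ H)

InR : ∀ {m n} → Pattern m n → Matroid n → Set
InR {m} Y M' = ∀ (i : Fin m) → IsFlat M' (zeroSet Y i)

HasTriangle : ∀ {m n} → Pattern m n → ℕ → Set
HasTriangle {m} {n} Y k =
  Σ (Fin k → Fin m) λ ρ → Σ (Fin k → Fin n) λ γ →
    Injective _≡_ _≡_ ρ × Injective _≡_ _≡_ γ ×
    (∀ i → Y (ρ i) (γ i) ≡ true) ×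
    (∀ i j → i Data.Fin.< j → Y (ρ i) (γ j) ≡ false)

IsTri : ∀ {m n} → Pattern m n → ℕ → Set
IsTri Y t = HasTriangle Y t × (∀ k → HasTriangle Y k → k ≤ t)

IsMinRank : ∀ {m n} → Pattern m n → ℕ → Set
IsMinRank {n = n} Y t =
  (Σ (Matroid n) λ M' → InR Y M' × rank M' ≡ t) ×
  (∀ (M' : Matroid n) → InR Y M' → t ≤ rank M')

-- Every triangle of a pattern in R(X) is a chain of flats, each avoiding one more
-- element than the next, so its size bounds the rank from below. Conversely, for a
-- basis b₁, …, b_r of M the closures Hᵢ = cl(B - bᵢ) are hyperplanes with bᵢ ∉ Hᵢ and
-- bⱼ ∈ Hᵢ for j ≠ i; they are rows of the fundamental pattern and form an r × r
-- triangle. For uniqueness, let M' ∈ R(X) have rank r(M) and take S ⊆ E(M): extend a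
-- basis J of S by N to a basis of M. The diagonal hyperplanes of N all contain S and
-- are flats of M', which forces r'(S) + |N| ≤ r(M) = |J| + |N|; those of J show
-- r'(J) ≥ |J|. Hence r'(S) = |J| = r(S).
module Submission where

open import Defs
open import Data.Nat using (ℕ; zero; suc; _+_; _≤_; _<_; z≤n; s≤s)
open import Data.Nat.Properties
open import Data.Bool using (Bool; true; false; if_then_else_)
open import Data.Fin using (Fin; zero; suc; punchOut)
import Data.Fin.Properties as Fin
open import Data.Fin.Subset using (Subset; inside; outside; _∈_; _∉_; _⊆_; _∪_; _∩_; ⁅_⁆; ⊤; ⊥)
open import Data.Fin.Subset.Properties
  using (_∈?_; ⊥⊆; ∣⊥∣≡0; ⊆⊤; ⊆-trans; x∈⁅x⁆; x∈⁅y⁆⇒x≡y; ∣⁅x⁆∣≡1; p⊆p∪q; q⊆p∪q; x∈p∪q⁻; x∈p∩q⁺;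
         ∪-assoc; ∪-identityˡ; ∪-identityʳ; ∪-zeroʳ)
open import Data.Vec using (tabulate)
open import Data.Vec.Properties using (lookup∘tabulate; []=⇒lookup; lookup⇒[]=)
open import Data.Vec.Functional as Vector using (removeAt)
open import Data.Product using (_×_; _,_; proj₁; proj₂)
open import Data.Sum using ([_,_]′)
open import Data.List using (List; []; _∷_; filter; allFin)
open import Data.List.Relation.Unary.All using (All; []; _∷_)
import Data.List.Relation.Unary.All as All
open import Data.List.Relation.Unary.All.Properties using (all-filter)
open import Data.List.Relation.Unary.Any using (here; there)
import Data.List.Membership.Propositional as List
open import Data.List.Membership.Propositional.Properties using (∈-filter⁺; ∈-allFin)
open import Relation.Nullary using (Dec; yes; no; does; ¬?; contradiction)
open import Relation.Nullary.Decidable using (_×-dec_; dec-true)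
open import Relation.Binary using (tri<; tri≈; tri>)
open import Relation.Binary.PropositionalEquality using (_≡_; _≢_; refl; sym; trans; cong; subst; module ≡-Reasoning)
open import Function using (_∘_; id)
open import Function.Definitions using (Injective)

module _ {n : ℕ} where

  ∪-least : {X Y Z : Subset n} → X ⊆ Z → Y ⊆ Z → X ∪ Y ⊆ Z
  ∪-least {X} {Y} X⊆Z Y⊆Z x∈X∪Y = [ X⊆Z , Y⊆Z ]′ (x∈p∪q⁻ X Y x∈X∪Y)

  ⊆-∪ˡ : {X Y : Subset n} → X ⊆ X ∪ Y
  ⊆-∪ˡ {Y = Y} = p⊆p∪q Y

  ⊆-∪ʳ : {X Y : Subset n} → Y ⊆ X ∪ Y
  ⊆-∪ʳ {X} {Y} = q⊆p∪q X Y

  ⁅⁆-⊆ : {e : Fin n} {X : Subset n} → e ∈ X → ⁅ e ⁆ ⊆ X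
  ⁅⁆-⊆ {e} e∈X x∈⁅e⁆ = subst (_∈ _) (sym (x∈⁅y⁆⇒x≡y e x∈⁅e⁆)) e∈X

  ∈-tabulate⁺ : {f : Fin n → Bool} {e : Fin n} → f e ≡ inside → e ∈ tabulate f
  ∈-tabulate⁺ {f} {e} fe≡inside = lookup⇒[]= e (tabulate f) (trans (lookup∘tabulate f e) fe≡inside)

  ∈-tabulate⁻ : {f : Fin n → Bool} {e : Fin n} → e ∈ tabulate f → f e ≡ inside
  ∈-tabulate⁻ {f} {e} e∈ = trans (sym (lookup∘tabulate f e)) ([]=⇒lookup e∈)

  range : ∀ {q} → (Fin q → Fin n) → Subset n
  range {zero}  g = ⊥
  range {suc q} g = ⁅ g zero ⁆ ∪ range (g ∘ suc)

  ∈-range : ∀ {q} (g : Fin q → Fin n) i → g i ∈ range g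
  ∈-range g zero    = ⊆-∪ˡ (x∈⁅x⁆ (g zero))
  ∈-range g (suc i) = ⊆-∪ʳ (∈-range (g ∘ suc) i)

  range-⊆ : ∀ {q} {X : Subset n} (g : Fin q → Fin n) → (∀ i → g i ∈ X) → range g ⊆ X
  range-⊆ {zero}  g g∈X = ⊥⊆
  range-⊆ {suc q} g g∈X = ∪-least (⁅⁆-⊆ (g∈X zero)) (range-⊆ (g ∘ suc) (g∈X ∘ suc))

  ∈-range-removeAt : ∀ {q} (g : Fin (suc q) → Fin n) {i j} → j ≢ i → g j ∈ range (removeAt g i)
  ∈-range-removeAt g {i} {j} j≢i =
    subst (_∈ range (removeAt g i)) (cong g (Fin.punchIn-punchOut (j≢i ∘ sym)))
      (∈-range (removeAt g i) (punchOut (j≢i ∘ sym)))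

  fromList : List (Fin n) → Subset n
  fromList []       = ⊥
  fromList (e ∷ es) = ⁅ e ⁆ ∪ fromList es

  ∈-fromList : ∀ {e es} → e List.∈ es → e ∈ fromList es
  ∈-fromList {e} (here refl) = ⊆-∪ˡ (x∈⁅x⁆ e)
  ∈-fromList (there e∈es)    = ⊆-∪ʳ (∈-fromList e∈es)

  ⊆-fromList-filter : (C : Subset n) → C ⊆ fromList (filter (_∈? C) (allFin n))
  ⊆-fromList-filter C {e} e∈C = ∈-fromList (∈-filter⁺ (_∈? C) (∈-allFin e) e∈C)

  punctured : ∀ {q} → Subset n → (Fin q → Fin n) → Fin q → Subset n
  punctured {suc q} A g i = A ∪ range (removeAt g i)

  ⊆-punctured : ∀ {q} (A : Subset n) (g : Fin q → Fin n) i → A ⊆ punctured A g i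
  ⊆-punctured {suc q} A g i = ⊆-∪ˡ

  ∈-punctured : ∀ {q} (A : Subset n) (g : Fin q → Fin n) {i j} → j ≢ i → g j ∈ punctured A g i
  ∈-punctured {suc q} A g j≢i = ⊆-∪ʳ (∈-range-removeAt g j≢i)

module MatroidTheory {n : ℕ} (M : Matroid n) where

  private
    r : Subset n → ℕ
    r = rk M

    mono : {X Y : Subset n} → X ⊆ Y → r X ≤ r Y
    mono = rk-mono M

  rk-⊥ : r ⊥ ≡ 0
  rk-⊥ = n≤0⇒n≡0 (subst (r ⊥ ≤_) (∣⊥∣≡0 n) (rk-card M ⊥))

  rk-⁅⁆ : ∀ e → r ⁅ e ⁆ ≤ 1
  rk-⁅⁆ e = subst (r ⁅ e ⁆ ≤_) (∣⁅x⁆∣≡1 e) (rk-card M ⁅ e ⁆)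

  rk-∪ : ∀ X Y → r (X ∪ Y) ≤ r X + r Y
  rk-∪ X Y = ≤-trans (m≤m+n _ _) (rk-sub M X Y)

  rk-∪-⁅⁆ : ∀ X e → r (X ∪ ⁅ e ⁆) ≤ suc (r X)
  rk-∪-⁅⁆ X e = ≤-trans (rk-∪ X ⁅ e ⁆) (subst (r X + r ⁅ e ⁆ ≤_) (+-comm (r X) 1) (+-monoʳ-≤ (r X) (rk-⁅⁆ e)))

  rk-range : ∀ {q} (g : Fin q → Fin n) → r (range g) ≤ q
  rk-range {zero}  g = ≤-reflexive rk-⊥
  rk-range {suc q} g = ≤-trans (rk-∪ _ _) (+-mono-≤ (rk-⁅⁆ (g zero)) (rk-range (g ∘ suc)))

  rk-≤-rank : ∀ X → r X ≤ rank M
  rk-≤-rank X = mono ⊆⊤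

  -- Submodularity applied to T ∪ ⁅ e ⁆ and F: the rank jump of F at e is inherited by T.
  rk-<-∉flat : ∀ {T F e} → T ⊆ F → IsFlat M F → e ∉ F → r T < r (T ∪ ⁅ e ⁆)
  rk-<-∉flat {T} {F} {e} T⊆F F-flat e∉F = +-cancelˡ-≤ (r F) _ _ (begin
    r F + suc (r T)                                 ≡⟨ +-suc (r F) (r T) ⟩
    suc (r F) + r T                                 ≤⟨ +-mono-≤ (≤-trans (F-flat e e∉F) (mono F∪e⊆)) (mono T⊆) ⟩
    r ((T ∪ ⁅ e ⁆) ∪ F) + r ((T ∪ ⁅ e ⁆) ∩ F)        ≤⟨ rk-sub M (T ∪ ⁅ e ⁆) F ⟩
    r (T ∪ ⁅ e ⁆) + r F                             ≡⟨ +-comm (r (T ∪ ⁅ e ⁆)) (r F) ⟩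
    r F + r (T ∪ ⁅ e ⁆)                             ∎)
    where
    open ≤-Reasoning
    F∪e⊆ : F ∪ ⁅ e ⁆ ⊆ (T ∪ ⁅ e ⁆) ∪ F
    F∪e⊆ = ∪-least ⊆-∪ʳ (⊆-trans ⊆-∪ʳ ⊆-∪ˡ)
    T⊆ : T ⊆ (T ∪ ⁅ e ⁆) ∩ F
    T⊆ x∈T = x∈p∩q⁺ (⊆-∪ˡ x∈T , T⊆F x∈T)

  rk-chain : ∀ {p} (T : Subset n) (g : Fin p → Fin n) (F : Fin p → Subset n) →
             (∀ i → IsFlat M (F i)) → (∀ i → T ⊆ F i) → (∀ i → g i ∉ F i) →
             (∀ i j → i Data.Fin.< j → g j ∈ F i) → r T + p ≤ r (T ∪ range g)
  rk-chain {zero} T g F _ _ _ _ = ≤-trans (≤-reflexive (+-identityʳ (r T))) (mono ⊆-∪ˡ)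
  rk-chain {suc p} T g F F-flat T⊆F g∉F g∈F = begin
    r T + suc p                     ≡⟨ +-suc (r T) p ⟩
    suc (r T + p)                   ≤⟨ s≤s (rk-chain T (g ∘ suc) (F ∘ suc) (F-flat ∘ suc) (T⊆F ∘ suc) (g∉F ∘ suc)
                                                     (λ i j i<j → g∈F (suc i) (suc j) (s≤s i<j))) ⟩
    suc (r T′)                      ≤⟨ rk-<-∉flat T′⊆F₀ (F-flat zero) (g∉F zero) ⟩
    r (T′ ∪ ⁅ g zero ⁆)              ≤⟨ mono (∪-least (∪-least ⊆-∪ˡ (⊆-trans ⊆-∪ʳ ⊆-∪ʳ)) (⊆-trans ⊆-∪ˡ ⊆-∪ʳ)) ⟩
    r (T ∪ range g)                 ∎
    where
    open ≤-Reasoning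
    T′ = T ∪ range (g ∘ suc)
    T′⊆F₀ : T′ ⊆ F zero
    T′⊆F₀ = ∪-least (T⊆F zero) (range-⊆ (g ∘ suc) (λ j → g∈F zero (suc j) (s≤s z≤n)))

  cl : Subset n → Subset n
  cl A = tabulate (λ e → does (r (A ∪ ⁅ e ⁆) ≟ r A))

  ∈-cl⁺ : ∀ {A e} → r (A ∪ ⁅ e ⁆) ≡ r A → e ∈ cl A
  ∈-cl⁺ {A} {e} eq = ∈-tabulate⁺ (dec-true (r (A ∪ ⁅ e ⁆) ≟ r A) eq)

  ∈-cl⁻ : ∀ {A e} → e ∈ cl A → r (A ∪ ⁅ e ⁆) ≡ r A
  ∈-cl⁻ {A} {e} e∈clA = does-true (r (A ∪ ⁅ e ⁆) ≟ r A) (∈-tabulate⁻ e∈clA)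
    where
    does-true : ∀ {P : Set} (P? : Dec P) → does P? ≡ true → P
    does-true (yes p) _ = p

  ⊆-cl : ∀ {A} → A ⊆ cl A
  ⊆-cl {A} x∈A = ∈-cl⁺ (≤-antisym (mono (∪-least id (⁅⁆-⊆ x∈A))) (mono ⊆-∪ˡ))

  ∈-cl⇒rk-∪-⁅⁆-≤ : ∀ {A X e} → A ⊆ X → r X ≤ r A → e ∈ cl A → r (X ∪ ⁅ e ⁆) ≤ r A
  ∈-cl⇒rk-∪-⁅⁆-≤ {A} {X} {e} A⊆X rX≤rA e∈clA = +-cancelʳ-≤ (r A) _ _ (begin
    r (X ∪ ⁅ e ⁆) + r A                             ≤⟨ +-mono-≤ (mono X∪e⊆) (mono A⊆) ⟩
    r (X ∪ (A ∪ ⁅ e ⁆)) + r (X ∩ (A ∪ ⁅ e ⁆))        ≤⟨ rk-sub M X (A ∪ ⁅ e ⁆) ⟩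
    r X + r (A ∪ ⁅ e ⁆)                             ≤⟨ +-mono-≤ rX≤rA (≤-reflexive (∈-cl⁻ e∈clA)) ⟩
    r A + r A                                       ∎)
    where
    open ≤-Reasoning
    X∪e⊆ : X ∪ ⁅ e ⁆ ⊆ X ∪ (A ∪ ⁅ e ⁆)
    X∪e⊆ = ∪-least ⊆-∪ˡ (⊆-trans ⊆-∪ʳ ⊆-∪ʳ)
    A⊆ : A ⊆ X ∩ (A ∪ ⁅ e ⁆)
    A⊆ x∈A = x∈p∩q⁺ (A⊆X x∈A , ⊆-∪ˡ x∈A)

  rk-∪-fromList : ∀ {A es} → All (_∈ cl A) es → r (A ∪ fromList es) ≤ r A
  rk-∪-fromList {A} [] = ≤-reflexive (cong r (∪-identityʳ A))
  rk-∪-fromList {A} {e ∷ es} (e∈clA ∷ es⊆clA) =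
    ≤-trans (mono (∪-least (⊆-trans ⊆-∪ˡ ⊆-∪ˡ) (∪-least ⊆-∪ʳ (⊆-trans ⊆-∪ʳ ⊆-∪ˡ))))
      (∈-cl⇒rk-∪-⁅⁆-≤ ⊆-∪ˡ (rk-∪-fromList es⊆clA) e∈clA)

  rk-∪-⊆cl : ∀ {A C} → C ⊆ cl A → r (A ∪ C) ≡ r A
  rk-∪-⊆cl {A} {C} C⊆clA = ≤-antisym
    (≤-trans (mono (∪-least ⊆-∪ˡ (⊆-trans (⊆-fromList-filter C) ⊆-∪ʳ)))
      (rk-∪-fromList (All.map C⊆clA (all-filter (_∈? C) (allFin n)))))
    (mono ⊆-∪ˡ)

  rk-cl : ∀ A → r (cl A) ≡ r A
  rk-cl A = ≤-antisym (≤-trans (mono ⊆-∪ʳ) (≤-reflexive (rk-∪-⊆cl id))) (mono ⊆-cl)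

  cl-flat : ∀ A → IsFlat M (cl A)
  cl-flat A e e∉clA = subst (_< r (cl A ∪ ⁅ e ⁆)) (sym (rk-cl A))
    (<-≤-trans (≤∧≢⇒< (mono ⊆-∪ˡ) (e∉clA ∘ ∈-cl⁺ ∘ sym)) (mono (∪-least (⊆-trans ⊆-cl ⊆-∪ˡ) ⊆-∪ʳ)))

  cl-least : ∀ {A F} → A ⊆ F → IsFlat M F → cl A ⊆ F
  cl-least {A} {F} A⊆F F-flat {e} e∈clA with e ∈? F
  ... | yes e∈F = e∈F
  ... | no e∉F  = contradiction (∈-cl⁻ e∈clA) (<⇒≢ (rk-<-∉flat A⊆F F-flat e∉F) ∘ sym)

  -- A basis of S relative to A.
  record Extension (S A : Subset n) : Set where
    field
      size        : ℕ
      basis       : Fin size → Fin n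
      basis⊆      : ∀ i → basis i ∈ S
      independent : r (A ∪ range basis) ≡ r A + size
      spanning    : S ⊆ cl (A ∪ range basis)

  -- Greedy: add any element of S outside cl A and recurse. The budget f bounds the
  -- number of remaining steps, since each one raises the rank of A.
  extend-within : ∀ f (S A : Subset n) → r (A ∪ S) ≤ r A + f → Extension S A
  extend-within f S A budget with Fin.any? (λ e → (e ∈? S) ×-dec ¬? (r (A ∪ ⁅ e ⁆) ≟ r A))
  ... | no none = record
    { size = 0 ; basis = λ () ; basis⊆ = λ ()
    ; independent = trans (cong r (∪-identityʳ A)) (sym (+-identityʳ (r A)))
    ; spanning = λ {e} e∈S → subst (λ B → e ∈ cl B) (sym (∪-identityʳ A)) (∈-cl⁺ (spanned e e∈S))
    }
    where
    spanned : ∀ e → e ∈ S → r (A ∪ ⁅ e ⁆) ≡ r A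
    spanned e e∈S with r (A ∪ ⁅ e ⁆) ≟ r A
    ... | yes eq = eq
    ... | no neq = contradiction (e , e∈S , neq) none
  ... | yes (e , e∈S , raises) = grow f budget
    where
    A⁺ = A ∪ ⁅ e ⁆
    rA⁺ : r A⁺ ≡ suc (r A)
    rA⁺ = ≤-antisym (rk-∪-⁅⁆ A e) (≤∧≢⇒< (mono ⊆-∪ˡ) (raises ∘ sym))
    A⁺∪S⊆A∪S : A⁺ ∪ S ⊆ A ∪ S
    A⁺∪S⊆A∪S = ∪-least (∪-least ⊆-∪ˡ (⊆-trans (⁅⁆-⊆ e∈S) ⊆-∪ʳ)) ⊆-∪ʳ
    grow : ∀ f → r (A ∪ S) ≤ r A + f → Extension S A
    grow zero budget = contradiction (begin
        suc (r A)   ≡⟨ rA⁺ ⟨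
        r A⁺        ≤⟨ mono (∪-least ⊆-∪ˡ (⊆-trans (⁅⁆-⊆ e∈S) ⊆-∪ʳ)) ⟩
        r (A ∪ S)   ≤⟨ budget ⟩
        r A + 0     ≡⟨ +-identityʳ (r A) ⟩
        r A         ∎) (n≮n (r A))
      where open ≤-Reasoning
    grow (suc f) budget = record
      { size = suc size ; basis = e Vector.∷ basis
      ; basis⊆ = λ { zero → e∈S ; (suc i) → basis⊆ i }
      ; independent = begin
          r (A ∪ (⁅ e ⁆ ∪ range basis))   ≡⟨ cong r (sym (∪-assoc A ⁅ e ⁆ (range basis))) ⟩
          r (A⁺ ∪ range basis)           ≡⟨ independent ⟩
          r A⁺ + size                    ≡⟨ cong (_+ size) rA⁺ ⟩
          suc (r A) + size               ≡⟨ +-suc (r A) size ⟨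
          r A + suc size                 ∎
      ; spanning = subst (λ B → S ⊆ cl B) (∪-assoc A ⁅ e ⁆ (range basis)) spanning
      }
      where
      open ≡-Reasoning
      budget⁺ : r (A⁺ ∪ S) ≤ r A⁺ + f
      budget⁺ = ≤-trans (mono A⁺∪S⊆A∪S) (≤-trans budget (≤-reflexive (trans (+-suc (r A) f) (cong (_+ f) (sym rA⁺)))))
      open Extension (extend-within f S A⁺ budget⁺)

  extend : ∀ (S A : Subset n) → Extension S A
  extend S A = extend-within (r (A ∪ S)) S A (m≤n+m _ _)

  rk-extension : ∀ {S A} (E : Extension S A) → r (A ∪ S) ≡ r A + Extension.size E
  rk-extension {S} {A} E = trans (≤-antisym upper lower) independent
    where
    open Extension E
    upper : r (A ∪ S) ≤ r (A ∪ range basis)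
    upper = ≤-trans (mono (∪-least (⊆-trans ⊆-∪ˡ ⊆-∪ˡ) ⊆-∪ʳ)) (≤-reflexive (rk-∪-⊆cl spanning))
    lower : r (A ∪ range basis) ≤ r (A ∪ S)
    lower = mono (∪-least ⊆-∪ˡ (⊆-trans (range-⊆ basis basis⊆) ⊆-∪ʳ))

  rank-extension : ∀ {A} (E : Extension ⊤ A) → rank M ≡ r A + Extension.size E
  rank-extension {A} E = trans (cong r (sym (∪-zeroʳ A))) (rk-extension E)

  suc-rk-punctured : ∀ {q} (A : Subset n) (g : Fin q → Fin n) i → suc (r (punctured A g i)) ≤ r A + q
  suc-rk-punctured {suc q} A g i = begin
    suc (r (A ∪ range (removeAt g i)))   ≤⟨ s≤s (rk-∪ A _) ⟩
    suc (r A + r (range (removeAt g i))) ≤⟨ s≤s (+-monoʳ-≤ (r A) (rk-range (removeAt g i))) ⟩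
    suc (r A + q)                        ≡⟨ +-suc (r A) q ⟨
    r A + suc q                          ∎
    where open ≤-Reasoning

  -- For a basis g of M relative to A, the closures of A together with all but one of
  -- the gᵢ are hyperplanes, each missing exactly its own gᵢ.
  module Diagonal {q} (g : Fin q → Fin n) (A : Subset n)
                  (spans : rank M ≤ r (A ∪ range g)) (small : r A + q ≤ rank M) where

    hyperplane : Fin q → Subset n
    hyperplane i = cl (punctured A g i)

    rank≤rk-punctured-∪ : ∀ i → rank M ≤ r (punctured A g i ∪ ⁅ g i ⁆)
    rank≤rk-punctured-∪ i = ≤-trans spans (mono (∪-least (⊆-trans (⊆-punctured A g i) ⊆-∪ˡ) (range-⊆ g g∈)))
      where
      g∈ : ∀ j → g j ∈ punctured A g i ∪ ⁅ g i ⁆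
      g∈ j with j Fin.≟ i
      ... | yes refl = ⊆-∪ʳ (x∈⁅x⁆ (g j))
      ... | no j≢i   = ⊆-∪ˡ (∈-punctured A g j≢i)

    rk-punctured : ∀ i → suc (r (punctured A g i)) ≡ rank M
    rk-punctured i = ≤-antisym (≤-trans (suc-rk-punctured A g i) small)
      (≤-trans (rank≤rk-punctured-∪ i) (rk-∪-⁅⁆ _ (g i)))

    isHyperplane : ∀ i → IsHyperplane M (hyperplane i)
    isHyperplane i = cl-flat _ , trans (cong (_+ 1) (rk-cl _)) (trans (+-comm _ 1) (rk-punctured i))

    ⊆-hyperplane : ∀ i → A ⊆ hyperplane i
    ⊆-hyperplane i = ⊆-trans (⊆-punctured A g i) ⊆-cl

    ∈-hyperplane : ∀ {i j} → j ≢ i → g j ∈ hyperplane i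
    ∈-hyperplane j≢i = ⊆-cl (∈-punctured A g j≢i)

    ∉-hyperplane : ∀ i → g i ∉ hyperplane i
    ∉-hyperplane i gᵢ∈ = n≮n (rank M) (begin-strict
      rank M                            ≤⟨ rank≤rk-punctured-∪ i ⟩
      r (punctured A g i ∪ ⁅ g i ⁆)     ≡⟨ ∈-cl⁻ gᵢ∈ ⟩
      r (punctured A g i)               <⟨ n<1+n _ ⟩
      suc (r (punctured A g i))         ≡⟨ rk-punctured i ⟩
      rank M                            ∎)
      where open ≤-Reasoning

  extension-spans : ∀ {A} (E : Extension ⊤ A) → rank M ≤ r (A ∪ range (Extension.basis E))
  extension-spans E = ≤-reflexive (trans (rank-extension E) (sym (Extension.independent E)))

  extension-small : ∀ {A} (E : Extension ⊤ A) → r A + Extension.size E ≤ rank M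
  extension-small E = ≤-reflexive (sym (rank-extension E))

hyperplanes-flat⇒≈M : ∀ {n} (M M′ : Matroid n) → (∀ H → IsHyperplane M H → IsFlat M′ H) →
                      rank M′ ≡ rank M → M′ ≈M M
hyperplanes-flat⇒≈M {n} M M′ hyperplane-flat rank≡ S = ≤-antisym upper lower
  where
  open MatroidTheory M
  module M′ = MatroidTheory M′
  open Extension

  J = extend S ⊥
  B = ⊥ ∪ range (basis J)
  N = extend ⊤ B
  k = size J
  p = size N

  rk-B : rk M B ≡ k
  rk-B = trans (independent J) (cong (_+ k) rk-⊥)

  rk-S : rk M S ≡ k
  rk-S = trans (cong (rk M) (sym (∪-identityˡ S))) (trans (rk-extension J) (cong (_+ k) rk-⊥))

  rank≡k+p : rank M ≡ k + p
  rank≡k+p = trans (rank-extension N) (cong (_+ p) rk-B)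

  diagonal-chain : ∀ {q} (g : Fin q → Fin n) (A T : Subset n) spans small →
                   (∀ i → T ⊆ Diagonal.hyperplane g A spans small i) → rk M′ T + q ≤ rk M′ (T ∪ range g)
  diagonal-chain g A T spans small T⊆H =
    M′.rk-chain T g hyperplane (λ i → hyperplane-flat _ (isHyperplane i)) T⊆H ∉-hyperplane
      (λ i j i<j → ∈-hyperplane (Fin.<⇒≢ i<j ∘ sym))
    where open Diagonal g A spans small

  upper : rk M′ S ≤ rk M S
  upper = +-cancelʳ-≤ p _ _ (begin
    rk M′ S + p                    ≤⟨ diagonal-chain (basis N) B S (extension-spans N) (extension-small N) S⊆H ⟩
    rk M′ (S ∪ range (basis N))    ≤⟨ M′.rk-≤-rank _ ⟩
    rank M′                        ≡⟨ trans rank≡ rank≡k+p ⟩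
    k + p                          ≡⟨ cong (_+ p) rk-S ⟨
    rk M S + p                     ∎)
    where
    open ≤-Reasoning
    open Diagonal (basis N) B (extension-spans N) (extension-small N)
    S⊆H : ∀ i → S ⊆ hyperplane i
    S⊆H i = cl-least (⊆-hyperplane i) (proj₁ (isHyperplane i)) ∘ spanning J

  lower : rk M S ≤ rk M′ S
  lower = begin
    rk M S                          ≡⟨ rk-S ⟩
    k                               ≤⟨ m≤n+m k _ ⟩
    rk M′ ⊥ + k                     ≤⟨ diagonal-chain (basis J) (range (basis N)) ⊥ spans small (λ _ → ⊥⊆) ⟩
    rk M′ (⊥ ∪ range (basis J))     ≤⟨ rk-mono M′ (∪-least ⊥⊆ (range-⊆ (basis J) (basis⊆ J))) ⟩
    rk M′ S                         ∎
    where
    open ≤-Reasoning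
    spans : rank M ≤ rk M (range (basis N) ∪ range (basis J))
    spans = ≤-trans (extension-spans N) (rk-mono M (∪-least (∪-least ⊥⊆ ⊆-∪ʳ) ⊆-∪ˡ))
    small : rk M (range (basis N)) + k ≤ rank M
    small = ≤-trans (+-monoˡ-≤ k (rk-range (basis N))) (≤-reflexive (trans (+-comm p k) (sym rank≡k+p)))

injective-if-< : ∀ {k} {A : Set} (f : Fin k → A) → (∀ {i j} → i Data.Fin.< j → f i ≢ f j) → Injective _≡_ _≡_ f
injective-if-< f distinct {i} {j} fi≡fj with Fin.<-cmp i j
... | tri< i<j _ _ = contradiction fi≡fj (distinct i<j)
... | tri≈ _ i≡j _ = i≡j
... | tri> _ _ j<i = contradiction (sym fi≡fj) (distinct j<i)

module _ {m n : ℕ} (Y : Pattern m n) where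

  ∈-zeroSet⁺ : ∀ {i e} → Y i e ≡ false → e ∈ zeroSet Y i
  ∈-zeroSet⁺ Yie≡false = ∈-tabulate⁺ (cong (λ b → if b then outside else inside) Yie≡false)

  ∈-zeroSet⁻ : ∀ {i e} → e ∈ zeroSet Y i → Y i e ≡ false
  ∈-zeroSet⁻ {i} {e} e∈ = if-inside (Y i e) (∈-tabulate⁻ e∈)
    where
    if-inside : ∀ b → (if b then outside else inside) ≡ inside → b ≡ false
    if-inside false _ = refl

  ∉-zeroSet⁻ : ∀ {i e} → e ∉ zeroSet Y i → Y i e ≡ true
  ∉-zeroSet⁻ {i} {e} e∉ with Y i e in Yie
  ... | true  = refl
  ... | false = contradiction (∈-zeroSet⁺ Yie) e∉

  lowerTriangle⇒HasTriangle : ∀ {k} (ρ : Fin k → Fin m) (γ : Fin k → Fin n) →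
    (∀ i → Y (ρ i) (γ i) ≡ true) → (∀ i j → i Data.Fin.< j → Y (ρ i) (γ j) ≡ false) → HasTriangle Y k
  lowerTriangle⇒HasTriangle ρ γ diagonal below =
    ρ , γ , injective-if-< ρ ρ-distinct , injective-if-< γ γ-distinct , diagonal , below
    where
    ρ-distinct : ∀ {i j} → i Data.Fin.< j → ρ i ≢ ρ j
    ρ-distinct {i} {j} i<j ρi≡ρj with trans (sym (below i j i<j)) (trans (cong (λ x → Y x (γ j)) ρi≡ρj) (diagonal j))
    ... | ()
    γ-distinct : ∀ {i j} → i Data.Fin.< j → γ i ≢ γ j
    γ-distinct {i} {j} i<j γi≡γj with trans (sym (below i j i<j)) (trans (cong (Y (ρ i)) (sym γi≡γj)) (diagonal i))
    ... | ()

  triangle≤rank : ∀ {k} (M′ : Matroid n) → InR Y M′ → HasTriangle Y k → k ≤ rank M′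
  triangle≤rank {k} M′ M′∈R (ρ , γ , _ , _ , diagonal , below) = begin
    k                       ≤⟨ m≤n+m k _ ⟩
    rk M′ ⊥ + k             ≤⟨ MatroidTheory.rk-chain M′ ⊥ γ (zeroSet Y ∘ ρ) (M′∈R ∘ ρ) (λ _ → ⊥⊆)
                                 (λ i γi∈ → contradiction (trans (sym (diagonal i)) (∈-zeroSet⁻ γi∈)) λ ())
                                 (λ i j i<j → ∈-zeroSet⁺ (below i j i<j)) ⟩
    rk M′ (⊥ ∪ range γ)     ≤⟨ MatroidTheory.rk-≤-rank M′ _ ⟩
    rank M′                 ∎
    where open ≤-Reasoning

module FundamentalPattern {m n : ℕ} (M : Matroid n) (X : Pattern m n) (fp : IsFundamentalPattern M X) where
  open MatroidTheory M

  M∈R : InR X M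
  M∈R i = proj₁ (proj₁ fp i)

  hyperplane-flat : ∀ M′ → InR X M′ → ∀ H → IsHyperplane M H → IsFlat M′ H
  hyperplane-flat M′ M′∈R H H-hyp with proj₂ (proj₂ fp) H H-hyp
  ... | i , refl = M′∈R i

  hasTriangle-rank : HasTriangle X (rank M)
  hasTriangle-rank = subst (HasTriangle X) (sym rank≡size)
    (lowerTriangle⇒HasTriangle X row basis
      (λ i → ∉-zeroSet⁻ X (subst (basis i ∉_) (sym (row-zeroSet i)) (∉-hyperplane i)))
      (λ i j i<j → ∈-zeroSet⁻ X (subst (basis j ∈_) (sym (row-zeroSet i)) (∈-hyperplane (Fin.<⇒≢ i<j ∘ sym)))))
    where
    E = extend ⊤ ⊥
    open Extension E
    open Diagonal basis ⊥ (extension-spans E) (extension-small E)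
    rank≡size : rank M ≡ size
    rank≡size = trans (rank-extension E) (cong (_+ size) rk-⊥)
    row : Fin size → Fin m
    row i = proj₁ (proj₂ (proj₂ fp) (hyperplane i) (isHyperplane i))
    row-zeroSet : ∀ i → zeroSet X (row i) ≡ hyperplane i
    row-zeroSet i = proj₂ (proj₂ (proj₂ fp) (hyperplane i) (isHyperplane i))

theorem5p2 : ∀ {m n : ℕ} (M : Matroid n) (X : Pattern m n) →
    IsFundamentalPattern M X →
    IsMinRank X (rank M) × IsTri X (rank M) ×
    InR X M × (∀ (M' : Matroid n) → InR X M' → rank M' ≡ rank M → M' ≈M M)
theorem5p2 M X fp =
  ((M , M∈R , refl) , λ M′ M′∈R → triangle≤rank X M′ M′∈R hasTriangle-rank) ,
  (hasTriangle-rank , λ k → triangle≤rank X M M∈R) ,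
  M∈R ,
  λ M′ M′∈R → hyperplanes-flat⇒≈M M M′ (hyperplane-flat M′ M′∈R)
  where open FundamentalPattern M X fp
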